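{- Let $G$ be a finite graph on $n$ vertices and let $k\le n$ be a natural number. Suppose $\mathcal{B}_{\geq k}(G)$ is neither a complete graph nor isomorphic to $K_5^-$. Then $k\le n-2$ if and only if $\mathcal{B}_{\geq k}(G)$ contains no universal vertex (i.e. no vertex adjacent to all other vertices of $\mathcal{B}_{\geq k}(G)$).
   Context: Graphs are finite and simple; $K_5^-$ is the graph obtained from the complete graph $K_5$ by deleting one edge. An independent set partition of $G$ is a partition of $V(G)$ into nonempty independent sets (parts). For such a partition $P$ and $v\in V(G)$, let $P-v$ be the partition of $V(G)\setminus\{v\}$ obtained by deleting $v$ from its part (discarding that part if empty). The Bell colouring graph $\mathcal{B}(G)$ has as vertices the independent set partitions of $G$, with $P\neq Q$ adjacent iff $P-v=Q-v$ for some $v\in V(G)$; $\mathcal{B}_{\geq k}(G)$ is its induced subgraph on partitions with at least $k$ parts. -}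

module Defs where

open import Data.Nat using (ℕ; zero; suc; _≤_; _∸_; _<ᵇ_)
open import Data.Bool using (Bool; true; false; not; _∧_; if_then_else_)
open import Data.Fin using (Fin; toℕ)
open import Data.List using (List; allFin; map)
open import Data.Bool.ListAction using (any)
open import Data.Nat.ListAction using (sum)
open import Data.Product using (Σ; Σ-syntax; ∃; ∃-syntax; _×_; _,_; proj₁)
open import Relation.Binary.PropositionalEquality using (_≡_; _≢_)
open import Relation.Nullary using (¬_)
open import Function.Bundles using (_⇔_)

record Graph (n : ℕ) : Set where
  field
    adj    : Fin n → Fin n → Bool
    sym    : ∀ u v → adj u v ≡ adj v u
    irrefl : ∀ v → adj v v ≡ false
open Graph public

-- An independent set partition of G, given by its "same part" relation,
-- which must be an equivalence relation whose classes are independent sets.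
-- (Parts are equivalence classes, hence automatically nonempty.)
record ISPartition {n : ℕ} (G : Graph n) : Set where
  field
    same       : Fin n → Fin n → Bool
    same-refl  : ∀ u → same u u ≡ true
    same-sym   : ∀ u w → same u w ≡ same w u
    same-trans : ∀ u v w → same u v ≡ true → same v w ≡ true → same u w ≡ true
    indep      : ∀ u w → same u w ≡ true → adj G u w ≡ false
open ISPartition public

module _ {n : ℕ} {G : Graph n} where

  _≈P_ : ISPartition G → ISPartition G → Set
  P ≈P Q = ∀ u w → same P u w ≡ same Q u w

  -- P - v = Q - v : the partitions induced on V(G) \ {v} coincide.
  DelEq : Fin n → ISPartition G → ISPartition G → Set
  DelEq v P Q = ∀ u w → u ≢ v → w ≢ v → same P u w ≡ same Q u w

  isLeader : ISPartition G → Fin n → Bool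
  isLeader P u = not (any (λ w → (toℕ w <ᵇ toℕ u) ∧ same P w u) (allFin n))

  -- Number of parts = number of parts' least elements.
  numParts : ISPartition G → ℕ
  numParts P = sum (map (λ u → if isLeader P u then 1 else 0) (allFin n))

  BAdj : ISPartition G → ISPartition G → Set
  BAdj P Q = ¬ (P ≈P Q) × ∃[ v ] DelEq v P Q

BVert : {n : ℕ} → Graph n → ℕ → Set
BVert G k = Σ[ P ∈ ISPartition G ] k ≤ numParts P

module _ {n : ℕ} {G : Graph n} {k : ℕ} where

  _≈B_ : BVert G k → BVert G k → Set
  P ≈B Q = proj₁ P ≈P proj₁ Q

  BkAdj : BVert G k → BVert G k → Set
  BkAdj P Q = BAdj (proj₁ P) (proj₁ Q)

BkComplete : {n : ℕ} → Graph n → ℕ → Set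
BkComplete G k = ∀ (P Q : BVert G k) → ¬ (P ≈B Q) → BkAdj P Q

BkUniversal : {n : ℕ} (G : Graph n) (k : ℕ) → BVert G k → Set
BkUniversal G k P = ∀ (Q : BVert G k) → ¬ (P ≈B Q) → BkAdj P Q

K5⁻Adj : Fin 5 → Fin 5 → Set
K5⁻Adj i j = i ≢ j × ¬ (toℕ i ≡ 0 × toℕ j ≡ 1) × ¬ (toℕ i ≡ 1 × toℕ j ≡ 0)

BkIsoK5⁻ : {n : ℕ} → Graph n → ℕ → Set
BkIsoK5⁻ G k =
  Σ[ f ∈ (BVert G k → Fin 5) ] Σ[ g ∈ (Fin 5 → BVert G k) ]
    (∀ P Q → P ≈B Q → f P ≡ f Q) ×
    (∀ P → g (f P) ≈B P) ×
    (∀ i → f (g i) ≡ i) ×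
    (∀ P Q → BkAdj P Q ⇔ K5⁻Adj (f P) (f Q))

{-# OPTIONS --safe #-}
module Submission where

-- For k ≤ n − 2 every partition with at least n − 2 parts is a vertex of B≥k(G). A universal
-- vertex U must then agree, after deleting one vertex, with the discrete partition, with {p,q}
-- and with {p,q}{r,s} for any two disjoint non-edges pq, rs, and these three demands are
-- incompatible. So any two non-edges of G meet: they form a star, and then B≥k(G) is complete,
-- or a triangle abc, and then the partitions of G are the five partitions of {a,b,c} and
-- B≥k(G) ≅ K₅⁻. For k ≥ n − 1 a partition in B≥k(G) has at most one non-singleton part, a pair
-- {u,w}, so deleting u makes it discrete: the discrete partition is universal.

open import Defs
open import Data.Nat using (ℕ; _≤_; _∸_)
open import Data.Product using (∃-syntax)
open import Relation.Nullary using (¬_)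
open import Function.Bundles using (_⇔_)

open import Data.Bool using (Bool; true; false; not; if_then_else_)
open import Data.Bool.Properties as Bool using (¬-not; T-≡; T-∧; not-injective)
open import Data.Empty using (⊥; ⊥-elim)
open import Data.Fin as Fin using (Fin; zero; suc; toℕ; punchIn)
open import Data.Fin.Induction using (<-wellFounded)
open import Data.Fin.Patterns using (0F; 1F; 2F; 3F; 4F)
import Data.Fin.Properties as Fin
open import Data.List using (tabulate; allFin)
open import Data.List.Properties using (map-tabulate)
open import Data.List.Relation.Unary.Any.Properties using (any⁺; any⁻; tabulate⁺; tabulate⁻)
open import Data.Nat as ℕ using (zero; suc; _+_; z≤n; s≤s)
open import Data.Nat.ListAction using (sum)
import Data.Nat.Properties as ℕ
open import Algebra.Properties.CommutativeSemigroup ℕ.+-commutativeSemigroup using (x∙yz≈y∙xz)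
open import Data.Product using (_×_; _,_; proj₁; proj₂)
open import Data.Sum using (_⊎_; inj₁; inj₂; [_,_]′; swap; reduce)
import Data.Sum.Properties as Sum
open import Function using (_∘_; id)
open import Function.Bundles using (Equivalence; mk⇔)
import Function.Properties.Equivalence as ⇔
open import Induction.WellFounded using (Acc; acc)
open import Relation.Binary using (DecidableEquality; tri<; tri≈; tri>)
open import Relation.Binary.PropositionalEquality as ≡
  using (_≡_; _≢_; refl; trans; cong; cong₂; subst; ≢-sym; module ≡-Reasoning)
open import Relation.Nullary using (Dec; yes; no; does)
open import Relation.Nullary.Decidable as Dec
  using (dec-true; dec-false; does-⇔; _⊎-dec_; _×-dec_; _→-dec_; ¬?; from-yes)

module _ {A : Set} where

  Pair : A → A → A → A → Set
  Pair p q x y = (x ≡ p × y ≡ q) ⊎ (x ≡ q × y ≡ p)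

  In₂ : A → A → A → Set
  In₂ p q x = x ≡ p ⊎ x ≡ q

  In₃ : A → A → A → A → Set
  In₃ a b c x = x ≡ a ⊎ x ≡ b ⊎ x ≡ c

  Pair⇒In₂ˡ : ∀ {p q x y} → Pair p q x y → In₂ p q x
  Pair⇒In₂ˡ (inj₁ (x≡p , _)) = inj₁ x≡p
  Pair⇒In₂ˡ (inj₂ (x≡q , _)) = inj₂ x≡q

  Pair⇒In₂ʳ : ∀ {p q x y} → Pair p q x y → In₂ p q y
  Pair⇒In₂ʳ (inj₁ (_ , y≡q)) = inj₂ y≡q
  Pair⇒In₂ʳ (inj₂ (_ , y≡p)) = inj₁ y≡p

  other₂ : ∀ {p q ℓ} → In₂ p q ℓ → ∃[ z ] ∀ {u} → In₂ p q u → u ≢ ℓ → u ≡ z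
  other₂ {q = q} (inj₁ refl) = q , λ where
    (inj₁ refl) u≢ℓ → ⊥-elim (u≢ℓ refl)
    (inj₂ u≡q)  _   → u≡q
  other₂ {p = p} (inj₂ refl) = p , λ where
    (inj₁ u≡p)  _   → u≡p
    (inj₂ refl) u≢ℓ → ⊥-elim (u≢ℓ refl)

  others₃ : ∀ {a b c ℓ} → In₃ a b c ℓ → ∃[ z₁ ] ∃[ z₂ ] ∀ {u} → In₃ a b c u → u ≢ ℓ → In₂ z₁ z₂ u
  others₃ {b = b} {c} (inj₁ refl) = b , c , λ where
    (inj₁ refl)        u≢ℓ → ⊥-elim (u≢ℓ refl)
    (inj₂ (inj₁ u≡b))  _   → inj₁ u≡b
    (inj₂ (inj₂ u≡c))  _   → inj₂ u≡c
  others₃ {a = a} {c = c} (inj₂ (inj₁ refl)) = a , c , λ where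
    (inj₁ u≡a)         _   → inj₁ u≡a
    (inj₂ (inj₁ refl)) u≢ℓ → ⊥-elim (u≢ℓ refl)
    (inj₂ (inj₂ u≡c))  _   → inj₂ u≡c
  others₃ {a = a} {b} (inj₂ (inj₂ refl)) = a , b , λ where
    (inj₁ u≡a)         _   → inj₁ u≡a
    (inj₂ (inj₁ u≡b))  _   → inj₂ u≡b
    (inj₂ (inj₂ refl)) u≢ℓ → ⊥-elim (u≢ℓ refl)

  ∉-pair : ∀ {p q r v : A} → p ≢ r → q ≢ r → In₂ p q v → r ≢ v
  ∉-pair p≢r _   (inj₁ refl) refl = p≢r refl
  ∉-pair _   q≢r (inj₂ refl) refl = q≢r refl

  In₂-disjoint : ∀ {p q r s v : A} → p ≢ r → p ≢ s → q ≢ r → q ≢ s → In₂ p q v → ¬ In₂ r s v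
  In₂-disjoint p≢r p≢s q≢r q≢s v∈pq =
    [ ∉-pair p≢r q≢r v∈pq ∘ ≡.sym , ∉-pair p≢s q≢s v∈pq ∘ ≡.sym ]′

-- Counting

indicator : Bool → ℕ
indicator b = if b then 1 else 0

count : ∀ {m} → (Fin m → Bool) → ℕ
count f = sum (tabulate (indicator ∘ f))

count-punchIn : ∀ {m} (f : Fin (suc m) → Bool) z →
                count f ≡ indicator (f z) + count (f ∘ punchIn z)
count-punchIn f zero = refl
count-punchIn {suc m} f (suc z) =
  trans (cong (indicator (f zero) +_) (count-punchIn (f ∘ suc) z))
    (x∙yz≈y∙xz (indicator (f zero)) (indicator (f (suc z))) (count (f ∘ suc ∘ punchIn z)))

count≤ : ∀ {m} (f : Fin m → Bool) → count f ≤ m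
count≤ {zero} f = z≤n
count≤ {suc m} f with f zero
... | true  = s≤s (count≤ (f ∘ suc))
... | false = ℕ.m≤n⇒m≤1+n (count≤ (f ∘ suc))

count-true : ∀ {m} (f : Fin m → Bool) → (∀ i → f i ≡ true) → count f ≡ m
count-true {zero} f _ = refl
count-true {suc m} f all-true rewrite all-true zero =
  cong suc (count-true (f ∘ suc) (all-true ∘ suc))

count-punchIn-≥ : ∀ {m} (f : Fin (suc m) → Bool) z → count (f ∘ punchIn z) ≤ count f
count-punchIn-≥ f z = subst (count (f ∘ punchIn z) ≤_) (≡.sym (count-punchIn f z))
  (ℕ.m≤n+m _ (indicator (f z)))

count-punchIn-false : ∀ {m} (f : Fin (suc m) → Bool) {z} → f z ≡ false →
                      count f ≡ count (f ∘ punchIn z)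
count-punchIn-false f {z} fz≡false =
  trans (count-punchIn f z) (cong (λ b → indicator b + count (f ∘ punchIn z)) fz≡false)

count-falseAt : ∀ {m} (f : Fin m → Bool) z → f z ≡ false → suc (count f) ≤ m
count-falseAt {suc m} f z fz≡false =
  s≤s (subst (_≤ m) (≡.sym (count-punchIn-false f fz≡false)) (count≤ (f ∘ punchIn z)))

count-falseAt₂ : ∀ {m} (f : Fin m → Bool) {z₁ z₂} → z₁ ≢ z₂ →
                 f z₁ ≡ false → f z₂ ≡ false → 2 + count f ≤ m
count-falseAt₂ {suc m} f {z₁} {z₂} z₁≢z₂ f₁ f₂ =
  subst (λ c → 2 + c ≤ suc m) (≡.sym (count-punchIn-false f f₁))
    (s≤s (count-falseAt (f ∘ punchIn z₁) (Fin.punchOut z₁≢z₂)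
      (trans (cong f (Fin.punchIn-punchOut z₁≢z₂)) f₂)))

count-falseOnlyAt₁ : ∀ {m} (f : Fin m → Bool) z → (∀ i → f i ≡ false → i ≡ z) → m ≤ suc (count f)
count-falseOnlyAt₁ {suc m} f z only = s≤s (subst (_≤ count f) (count-true (f ∘ punchIn z) rest-true)
  (count-punchIn-≥ f z))
  where
  rest-true : ∀ i → f (punchIn z i) ≡ true
  rest-true i = ¬-not (Fin.punchInᵢ≢i z i ∘ only (punchIn z i))

count-falseOnlyAt₂ : ∀ {m} (f : Fin m → Bool) z₁ z₂ → (∀ i → f i ≡ false → In₂ z₁ z₂ i) →
                     m ≤ 2 + count f
count-falseOnlyAt₂ f z₁ z₂ only with z₁ Fin.≟ z₂
... | yes refl = ℕ.m≤n⇒m≤1+n (count-falseOnlyAt₁ f z₁ λ i fi → reduce (only i fi))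
count-falseOnlyAt₂ {suc m} f z₁ z₂ only | no z₁≢z₂ =
  s≤s (ℕ.≤-trans (count-falseOnlyAt₁ (f ∘ punchIn z₁) (Fin.punchOut z₁≢z₂) rest-only)
    (s≤s (count-punchIn-≥ f z₁)))
  where
  rest-only : ∀ i → f (punchIn z₁ i) ≡ false → i ≡ Fin.punchOut z₁≢z₂
  rest-only i fi with only (punchIn z₁ i) fi
  ... | inj₁ e = ⊥-elim (Fin.punchInᵢ≢i z₁ i e)
  ... | inj₂ e = Fin.punchIn-injective z₁ i _ (trans e (≡.sym (Fin.punchIn-punchOut z₁≢z₂)))

does⇒ : ∀ {A : Set} (a? : Dec A) → does a? ≡ true → A
does⇒ (yes a) _ = a

redirect : ∀ {n} → Fin n → Fin n → Fin n → Fin n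
redirect q p x with x Fin.≟ q
... | yes _ = p
... | no _  = x

redirect-source : ∀ {n} (q : Fin n) {p} → redirect q p q ≡ p
redirect-source q with q Fin.≟ q
... | yes _  = refl
... | no q≢q = ⊥-elim (q≢q refl)

module _ {n : ℕ} {q p : Fin n} where

  redirect-other : ∀ {x} → x ≢ q → redirect q p x ≡ x
  redirect-other {x} x≢q with x Fin.≟ q
  ... | yes x≡q = ⊥-elim (x≢q x≡q)
  ... | no _    = refl

  redirect-fibre : ∀ {x y} → x ≢ y → redirect q p x ≡ redirect q p y → Pair p q x y
  redirect-fibre {x} {y} x≢y fx≡fy with x Fin.≟ q | y Fin.≟ q
  ... | yes x≡q | yes y≡q = ⊥-elim (x≢y (trans x≡q (≡.sym y≡q)))
  ... | yes x≡q | no _    = inj₂ (x≡q , ≡.sym fx≡fy)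
  ... | no _    | yes y≡q = inj₁ (fx≡fy , y≡q)
  ... | no _    | no _    = ⊥-elim (x≢y fx≡fy)

  redirect-preimage : ∀ {x z} → redirect q p x ≡ z → z ≢ p → x ≡ z
  redirect-preimage {x} fx≡z z≢p with x Fin.≟ q
  ... | yes _ = ⊥-elim (z≢p (≡.sym fx≡z))
  ... | no _  = fx≡z

-- Non-edges and partitions into fibres

record NonEdge {n} (G : Graph n) (x y : Fin n) : Set where
  constructor nonEdge
  field
    distinct    : x ≢ y
    nonadjacent : adj G x y ≡ false
open NonEdge public

nonEdge-adj : ∀ {n} {G : Graph n} {p q x y} → NonEdge G p q → Pair p q x y → adj G x y ≡ false
nonEdge-adj (nonEdge _ p≁q) (inj₁ (refl , refl)) = p≁q
nonEdge-adj {G = G} (nonEdge _ p≁q) (inj₂ (refl , refl)) = trans (Graph.sym G _ _) p≁q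

module _ {n : ℕ} {G : Graph n} where

  nonEdge? : ∀ x y → Dec (NonEdge G x y)
  nonEdge? x y = Dec.map′ (λ (x≢y , x≁y) → nonEdge x≢y x≁y) (λ e → distinct e , nonadjacent e)
    (¬? (x Fin.≟ y) ×-dec (adj G x y Bool.≟ false))

  nonEdge-sym : ∀ {x y} → NonEdge G x y → NonEdge G y x
  nonEdge-sym (nonEdge x≢y x≁y) = nonEdge (≢-sym x≢y) (trans (Graph.sym G _ _) x≁y)

  same⇒nonEdge : (P : ISPartition G) {x y : Fin n} → x ≢ y → same P x y ≡ true → NonEdge G x y
  same⇒nonEdge P x≢y x~y = nonEdge x≢y (indep P _ _ x~y)

module _ {n : ℕ} (G : Graph n) where

  fibres : {A : Set} → DecidableEquality A → (f : Fin n → A) →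
           (∀ {x y} → x ≢ y → f x ≡ f y → adj G x y ≡ false) → ISPartition G
  fibres _≟ᴬ_ f indep = record
    { same       = λ x y → does (f x ≟ᴬ f y)
    ; same-refl  = λ x → dec-true (f x ≟ᴬ f x) refl
    ; same-sym   = λ x y → does-⇔ (mk⇔ ≡.sym ≡.sym) (f x ≟ᴬ f y) (f y ≟ᴬ f x)
    ; same-trans = λ x y z x~y y~z →
        dec-true (f x ≟ᴬ f z) (trans (does⇒ (f x ≟ᴬ f y) x~y) (does⇒ (f y ≟ᴬ f z) y~z))
    ; indep      = λ x y x~y → independent x y (does⇒ (f x ≟ᴬ f y) x~y)
    }
    where
    independent : ∀ x y → f x ≡ f y → adj G x y ≡ false
    independent x y fx≡fy with x Fin.≟ y
    ... | yes refl = irrefl G x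
    ... | no x≢y   = indep x≢y fx≡fy

  discrete : ISPartition G
  discrete = fibres Fin._≟_ id (λ x≢y x≡y → ⊥-elim (x≢y x≡y))

-- Leaders and the number of parts

module _ {n : ℕ} {G : Graph n} where

  nonLeader⇒partner : (P : ISPartition G) {u : Fin n} →
                      isLeader P u ≡ false → ∃[ w ] w Fin.< u × same P w u ≡ true
  nonLeader⇒partner P {u} notLeader
    with w , w<u∧w~u ←
           tabulate⁻ (any⁻ _ (allFin n) (Equivalence.from T-≡ (not-injective notLeader)))
    with w<u , w~u ← Equivalence.to T-∧ w<u∧w~u
    = w , ℕ.<ᵇ⇒< (toℕ w) (toℕ u) w<u , Equivalence.to T-≡ w~u

  partner⇒nonLeader : (P : ISPartition G) {w u : Fin n} →
                      w Fin.< u → same P w u ≡ true → isLeader P u ≡ false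
  partner⇒nonLeader P {w} w<u w~u = cong not (Equivalence.to T-≡
    (any⁺ _ (tabulate⁺ w (Equivalence.from T-∧ (ℕ.<⇒<ᵇ w<u , Equivalence.from T-≡ w~u)))))

  leaderOf : (P : ISPartition G) (x : Fin n) → ∃[ ℓ ] isLeader P ℓ ≡ true × same P ℓ x ≡ true
  leaderOf P x = go x (<-wellFounded x)
    where
    go : ∀ x → Acc Fin._<_ x → ∃[ ℓ ] isLeader P ℓ ≡ true × same P ℓ x ≡ true
    go x (acc smaller) with isLeader P x in leader
    ... | true = x , leader , same-refl P x
    ... | false with w , w<x , w~x ← nonLeader⇒partner P leader
                with ℓ , ℓ-leader , ℓ~w ← go w (smaller w<x)
                = ℓ , ℓ-leader , same-trans P ℓ w x ℓ~w w~x

  numParts≡count : (P : ISPartition G) → numParts P ≡ count (isLeader P)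
  numParts≡count P = cong sum (map-tabulate id (indicator ∘ isLeader P))

  n∸2≤numParts : (P : ISPartition G) (z₁ z₂ : Fin n) →
                 (∀ u → isLeader P u ≡ false → In₂ z₁ z₂ u) → n ∸ 2 ≤ numParts P
  n∸2≤numParts P z₁ z₂ only = subst (n ∸ 2 ≤_) (≡.sym (numParts≡count P))
    (ℕ.m≤n+o⇒m∸n≤o n 2 (count-falseOnlyAt₂ (isLeader P) z₁ z₂ only))

  numParts≤n∸2 : (P : ISPartition G) {z₁ z₂ : Fin n} → z₁ ≢ z₂ →
                 isLeader P z₁ ≡ false → isLeader P z₂ ≡ false → numParts P ≤ n ∸ 2
  numParts≤n∸2 P z₁≢z₂ nl₁ nl₂ = subst (_≤ n ∸ 2) (≡.sym (numParts≡count P))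
    (ℕ.m+n≤o⇒m≤o∸n (count (isLeader P))
      (subst (_≤ n) (ℕ.+-comm 2 _) (count-falseAt₂ (isLeader P) z₁≢z₂ nl₁ nl₂)))

discrete-separates : ∀ {n} (G : Graph n) {x y} → x ≢ y → same (discrete G) x y ≡ false
discrete-separates G {x} {y} = dec-false (x Fin.≟ y)

numParts-discrete : ∀ {n} (G : Graph n) → numParts (discrete G) ≡ n
numParts-discrete G = trans (numParts≡count (discrete G)) (count-true _ all-leaders)
  where
  all-leaders : ∀ u → isLeader (discrete G) u ≡ true
  all-leaders u = ¬-not λ notLeader →
    let (w , w<u , w~u) = nonLeader⇒partner (discrete G) notLeader
    in Fin.<-irrefl (does⇒ (w Fin.≟ u) w~u) w<u

module _ {n : ℕ} {G : Graph n} where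

  nonLeader⇒paired : (P : ISPartition G) {u : Fin n} →
                     isLeader P u ≡ false → ∃[ w ] u ≢ w × same P u w ≡ true
  nonLeader⇒paired P {u} notLeader with w , w<u , w~u ← nonLeader⇒partner P notLeader =
    w , ≢-sym (Fin.<⇒≢ w<u) , trans (same-sym P u w) w~u

  leader≢nonLeader : (P : ISPartition G) {ℓ u : Fin n} →
                     isLeader P ℓ ≡ true → isLeader P u ≡ false → u ≢ ℓ
  leader≢nonLeader P leader notLeader refl with () ← trans (≡.sym leader) notLeader

  NontrivialWithin₃ : ISPartition G → Fin n → Fin n → Fin n → Set
  NontrivialWithin₃ P a b c = ∀ {x y} → x ≢ y → same P x y ≡ true → In₃ a b c x

  within₃-leader : (P : ISPartition G) {a b c ℓ : Fin n} →
                   NontrivialWithin₃ P a b c → same P ℓ a ≡ true → In₃ a b c ℓ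
  within₃-leader P {a} {ℓ = ℓ} within ℓ~a with ℓ Fin.≟ a
  ... | yes ℓ≡a = inj₁ ℓ≡a
  ... | no ℓ≢a  = within ℓ≢a ℓ~a

  n∸2≤numParts-within₃ : (P : ISPartition G) {a b c : Fin n} →
                         NontrivialWithin₃ P a b c → n ∸ 2 ≤ numParts P
  n∸2≤numParts-within₃ P {a} within
    with ℓ , ℓ-leader , ℓ~a ← leaderOf P a
    with z₁ , z₂ , rest ← others₃ (within₃-leader P within ℓ~a)
    = n∸2≤numParts P z₁ z₂ λ u notLeader →
        let (w , u≢w , u~w) = nonLeader⇒paired P notLeader
        in  rest (within u≢w u~w) (leader≢nonLeader P ℓ-leader notLeader)

  NontrivialWithin₂₂ : ISPartition G → Fin n → Fin n → Fin n → Fin n → Set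
  NontrivialWithin₂₂ P p q r s =
    ∀ {x y} → x ≢ y → same P x y ≡ true → Pair p q x y ⊎ Pair r s x y

  within₂₂-leader : (P : ISPartition G) {p q r s ℓ : Fin n} → p ≢ r → p ≢ s →
                    NontrivialWithin₂₂ P p q r s → same P ℓ p ≡ true → In₂ p q ℓ
  within₂₂-leader P {p = p} {ℓ = ℓ} p≢r p≢s within ℓ~p with ℓ Fin.≟ p
  ... | yes ℓ≡p = inj₁ ℓ≡p
  ... | no ℓ≢p with within ℓ≢p ℓ~p
  ...   | inj₁ ℓp∈pq = Pair⇒In₂ˡ ℓp∈pq
  ...   | inj₂ ℓp∈rs = ⊥-elim ([ p≢r , p≢s ]′ (Pair⇒In₂ʳ ℓp∈rs))

  n∸2≤numParts-within₂₂ : (P : ISPartition G) {p q r s : Fin n} →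
    p ≢ r → p ≢ s → q ≢ r → q ≢ s → NontrivialWithin₂₂ P p q r s → n ∸ 2 ≤ numParts P
  n∸2≤numParts-within₂₂ P {p} {q} {r} {s} p≢r p≢s q≢r q≢s within
    with ℓ₁ , ℓ₁-leader , ℓ₁~p ← leaderOf P p
    with ℓ₂ , ℓ₂-leader , ℓ₂~r ← leaderOf P r
    with z₁ , rest₁ ← other₂ (within₂₂-leader P p≢r p≢s within ℓ₁~p)
    with z₂ , rest₂ ← other₂ (within₂₂-leader P (≢-sym p≢r) (≢-sym q≢r)
                                (λ x≢y x~y → swap (within x≢y x~y)) ℓ₂~r)
    = n∸2≤numParts P z₁ z₂ λ u notLeader →
        let (w , u≢w , u~w) = nonLeader⇒paired P notLeader
        in  [ (λ uw∈pq → inj₁ (rest₁ (Pair⇒In₂ˡ uw∈pq) (leader≢nonLeader P ℓ₁-leader notLeader)))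
            , (λ uw∈rs → inj₂ (rest₂ (Pair⇒In₂ˡ uw∈rs) (leader≢nonLeader P ℓ₂-leader notLeader)))
            ]′ (within u≢w u~w)

  pair-nonLeader : (P : ISPartition G) {p q : Fin n} → p ≢ q → same P p q ≡ true →
                   ∃[ z ] In₂ p q z × isLeader P z ≡ false
  pair-nonLeader P {p} {q} p≢q p~q with Fin.<-cmp p q
  ... | tri< p<q _ _ = q , inj₂ refl , partner⇒nonLeader P p<q p~q
  ... | tri≈ _ p≡q _ = ⊥-elim (p≢q p≡q)
  ... | tri> _ _ q<p = p , inj₁ refl , partner⇒nonLeader P q<p (trans (same-sym P q p) p~q)

  numParts≤n∸2-triple : (P : ISPartition G) {u w y : Fin n} → u ≢ w → w ≢ y → u ≢ y →
                        same P u w ≡ true → same P w y ≡ true → numParts P ≤ n ∸ 2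
  numParts≤n∸2-triple P {u} {w} {y} u≢w w≢y u≢y u~w w~y
    with pair-nonLeader P u≢w u~w
  ... | m , inj₁ refl , m-nl
    with m′ , m′∈wy , m′-nl ← pair-nonLeader P w≢y w~y =
    numParts≤n∸2 P (∉-pair (≢-sym u≢w) (≢-sym u≢y) m′∈wy) m-nl m′-nl
  ... | m , inj₂ refl , m-nl
    with m′ , m′∈uy , m′-nl ← pair-nonLeader P u≢y (same-trans P u w y u~w w~y) =
    numParts≤n∸2 P (∉-pair u≢w (≢-sym w≢y) m′∈uy) m-nl m′-nl

  -- The larger end of each pair is a non-leader; if the two coincide, the part of u
  -- contains three vertices.
  numParts≤n∸2-twoPairs : (P : ISPartition G) {u w x y : Fin n} → u ≢ w → x ≢ y → x ≢ u → y ≢ u →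
                          same P u w ≡ true → same P x y ≡ true → numParts P ≤ n ∸ 2
  numParts≤n∸2-twoPairs P {x = x} {y} u≢w x≢y x≢u y≢u u~w x~y
    with m₁ , m₁∈uw , m₁-nl ← pair-nonLeader P u≢w u~w
    with m₂ , m₂∈xy , m₂-nl ← pair-nonLeader P x≢y x~y
    with m₁ Fin.≟ m₂
  ... | no m₁≢m₂ = numParts≤n∸2 P m₁≢m₂ m₁-nl m₂-nl
  ... | yes refl with m₁∈uw | m₂∈xy
  ...   | inj₁ refl | inj₁ refl = ⊥-elim (x≢u refl)
  ...   | inj₁ refl | inj₂ refl = ⊥-elim (y≢u refl)
  ...   | inj₂ refl | inj₁ refl = numParts≤n∸2-triple P u≢w x≢y (≢-sym y≢u) u~w x~y
  ...   | inj₂ refl | inj₂ refl =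
    numParts≤n∸2-triple P u≢w (≢-sym x≢y) (≢-sym x≢u) u~w (trans (same-sym P y x) x~y)

-- Agreement after deleting one vertex

module _ {n : ℕ} {G : Graph n} where

  DelEq⇒endpoint : {P Q : ISPartition G} {v x y : Fin n} →
                   DelEq v P Q → same P x y ≢ same Q x y → In₂ x y v
  DelEq⇒endpoint {v = v} {x} {y} agree differ with x Fin.≟ v | y Fin.≟ v
  ... | yes x≡v | _       = inj₁ (≡.sym x≡v)
  ... | no _    | yes y≡v = inj₂ (≡.sym y≡v)
  ... | no x≢v  | no y≢v  = ⊥-elim (differ (agree x y x≢v y≢v))

  ≈P-sym : {P Q : ISPartition G} → P ≈P Q → Q ≈P P
  ≈P-sym P≈Q x y = ≡.sym (P≈Q x y)

  BAdj-cong : {P P′ Q Q′ : ISPartition G} → P ≈P P′ → Q ≈P Q′ → BAdj P Q ⇔ BAdj P′ Q′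
  BAdj-cong {P} {P′} {Q} {Q′} P≈P′ Q≈Q′ =
    mk⇔ (transport {P} {P′} {Q} {Q′} P≈P′ Q≈Q′)
        (transport {P′} {P} {Q′} {Q} (≈P-sym {P = P} {P′} P≈P′) (≈P-sym {P = Q} {Q′} Q≈Q′))
    where
    transport : {R R′ S S′ : ISPartition G} → R ≈P R′ → S ≈P S′ → BAdj R S → BAdj R′ S′
    transport R≈R′ S≈S′ (R≉S , v , agree) =
      (λ R′≈S′ → R≉S λ x y → trans (R≈R′ x y) (trans (R′≈S′ x y) (≡.sym (S≈S′ x y)))) , v ,
      λ x y x≢v y≢v → trans (≡.sym (R≈R′ x y)) (trans (agree x y x≢v y≢v) (S≈S′ x y))

  _≈P?_ : (P Q : ISPartition G) → Dec (P ≈P Q)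
  P ≈P? Q = Fin.all? λ u → Fin.all? λ w → same P u w Bool.≟ same Q u w

  -- the given vertex serves when Q ≈P U
  universal⇒DelEq : ∀ {k} {U : BVert G k} → BkUniversal G k U →
                    (Q : ISPartition G) → k ≤ numParts Q → Fin n → ∃[ v ] DelEq v (proj₁ U) Q
  universal⇒DelEq {U = U , _} universal Q k≤Q v with U ≈P? Q
  ... | yes U≈Q = v , λ x y _ _ → U≈Q x y
  ... | no U≉Q  = proj₂ (universal (Q , k≤Q) U≉Q)

  ≉⇒disagreement : (P Q : ISPartition G) → ¬ P ≈P Q → ∃[ u ] ∃[ w ] same P u w ≢ same Q u w
  ≉⇒disagreement P Q P≉Q
    with u , ¬agree-at-u ← Fin.¬∀⟶∃¬ n _ (λ u → Fin.all? λ w → same P u w Bool.≟ same Q u w) P≉Q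
    with w , differ ← Fin.¬∀⟶∃¬ n _ (λ w → same P u w Bool.≟ same Q u w) ¬agree-at-u
    = u , w , differ

discreteVertex : ∀ {n} (G : Graph n) {k} → k ≤ n → BVert G k
discreteVertex G {k} k≤n = discrete G , subst (k ≤_) (≡.sym (numParts-discrete G)) k≤n

discrete-universal : ∀ {n} (G : Graph n) {k} (k≤n : k ≤ n) → n ∸ 2 ℕ.< k →
                     BkUniversal G k (discreteVertex G k≤n)
discrete-universal {n} G k≤n n∸2<k (Q , k≤Q) D≉Q =
  D≉Q , deleting (≉⇒disagreement (discrete G) Q D≉Q)
  where
  deleting : ∃[ u ] ∃[ w ] same (discrete G) u w ≢ same Q u w → ∃[ v ] DelEq v (discrete G) Q
  deleting (u , w , differ) = u , agree-off-u
    where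
    u≢w : u ≢ w
    u≢w refl = differ (trans (same-refl (discrete G) u) (≡.sym (same-refl Q u)))

    u~w : same Q u w ≡ true
    u~w = ¬-not (differ ∘ trans (discrete-separates G u≢w) ∘ ≡.sym)

    agree-off-u : DelEq u (discrete G) Q
    agree-off-u x y x≢u y≢u with x Fin.≟ y
    ... | yes refl = ≡.sym (same-refl Q x)
    ... | no x≢y   = ≡.sym (¬-not λ x~y → ℕ.<⇒≱ n∸2<k
      (ℕ.≤-trans k≤Q (numParts≤n∸2-twoPairs Q u≢w x≢y x≢u y≢u u~w x~y)))

-- Two disjoint non-edges

module _ {n : ℕ} (G : Graph n) {p q : Fin n} (pq : NonEdge G p q) where

  pairPartition : ISPartition G
  pairPartition = fibres G Fin._≟_ (redirect q p) λ x≢y e →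
    nonEdge-adj pq (redirect-fibre {q = q} {p} x≢y e)

  pairPartition-joins : same pairPartition p q ≡ true
  pairPartition-joins =
    dec-true (_ Fin.≟ _) (trans (redirect-other {p = p} (distinct pq)) (≡.sym (redirect-source q)))

  pairPartition-separates : ∀ {x y} → x ≢ y → x ≢ q → y ≢ q → same pairPartition x y ≡ false
  pairPartition-separates x≢y x≢q y≢q = dec-false (_ Fin.≟ _) λ e →
    x≢y (trans (≡.sym (redirect-other {p = p} x≢q)) (trans e (redirect-other {p = p} y≢q)))

  n∸2≤numParts-pairPartition : n ∸ 2 ≤ numParts pairPartition
  n∸2≤numParts-pairPartition = n∸2≤numParts pairPartition p q λ u notLeader →
    let (w , u≢w , u~w) = nonLeader⇒paired pairPartition notLeader
    in  Pair⇒In₂ˡ (redirect-fibre {q = q} {p} u≢w (does⇒ (_ Fin.≟ _) u~w))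

module _ {n : ℕ} (G : Graph n) {p q r s : Fin n} (pq : NonEdge G p q) (rs : NonEdge G r s)
         (p≢r : p ≢ r) (p≢s : p ≢ s) (q≢r : q ≢ r) (q≢s : q ≢ s) where

  private
    collapse : Fin n → Fin n
    collapse = redirect q p ∘ redirect s r

  matching-fibre : ∀ {x y} → x ≢ y → collapse x ≡ collapse y → Pair p q x y ⊎ Pair r s x y
  matching-fibre {x} {y} x≢y fx≡fy with redirect s r x Fin.≟ redirect s r y
  ... | yes e = inj₂ (redirect-fibre {q = s} {r} x≢y e)
  ... | no ne with redirect-fibre {q = q} {p} ne fx≡fy
  ...   | inj₁ (x′≡p , y′≡q) = inj₁ (inj₁ (redirect-preimage x′≡p p≢r , redirect-preimage y′≡q q≢r))
  ...   | inj₂ (x′≡q , y′≡p) = inj₁ (inj₂ (redirect-preimage x′≡q q≢r , redirect-preimage y′≡p p≢r))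

  matching : ISPartition G
  matching = fibres G Fin._≟_ collapse λ x≢y e →
    [ nonEdge-adj pq , nonEdge-adj rs ]′ (matching-fibre x≢y e)

  matching-joins₁ : same matching p q ≡ true
  matching-joins₁ = dec-true (_ Fin.≟ _) (begin
    redirect q p (redirect s r p) ≡⟨ cong (redirect q p) (redirect-other p≢s) ⟩
    redirect q p p                ≡⟨ redirect-other (distinct pq) ⟩
    p                             ≡⟨ redirect-source q ⟨
    redirect q p q                ≡⟨ cong (redirect q p) (redirect-other q≢s) ⟨
    redirect q p (redirect s r q) ∎)
    where open ≡-Reasoning

  matching-joins₂ : same matching r s ≡ true
  matching-joins₂ = dec-true (_ Fin.≟ _)
    (cong (redirect q p) (trans (redirect-other (distinct rs)) (≡.sym (redirect-source s))))

  n∸2≤numParts-matching : n ∸ 2 ≤ numParts matching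
  n∸2≤numParts-matching = n∸2≤numParts-within₂₂ matching p≢r p≢s q≢r q≢s
    λ x≢y x~y → matching-fibre x≢y (does⇒ (_ Fin.≟ _) x~y)

Intersecting : ∀ {n} → Graph n → Set
Intersecting G = ∀ {p q r s} → NonEdge G p q → NonEdge G r s → p ≢ r → p ≢ s → q ≢ r → q ≢ s → ⊥

module _ {n : ℕ} {G : Graph n} where

  -- D pins p ≁ q in U, so M's deleted vertex lies in {p, q}; hence r ~ s in U,
  -- so P's deleted vertex lies in {r, s}, and P then forces p ~ q in U.
  no-common-neighbour : {U D M P : ISPartition G} {p q r s v₀ v v₁ : Fin n} →
    p ≢ r → p ≢ s → q ≢ r → q ≢ s → ¬ In₂ p q v₀ →
    DelEq v₀ U D → same D p q ≡ false →
    DelEq v U M → same M p q ≡ true → same M r s ≡ true →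
    DelEq v₁ U P → same P p q ≡ true → same P r s ≡ false → ⊥
  no-common-neighbour {U} {D} {M} {P} {p} {q} {r} {s} {v₀} {v} {v₁} p≢r p≢s q≢r q≢s v₀∉pq
                      U~D D-pq U~M M-pq M-rs U~P P-pq P-rs =
    mismatch U-pq (trans (U~P p q p≢v₁ q≢v₁) P-pq) refl
    where
    mismatch : ∀ {a b} → a ≡ false → b ≡ true → a ≢ b
    mismatch refl refl ()

    U-pq : same U p q ≡ false
    U-pq = trans (U~D p q (v₀∉pq ∘ inj₁ ∘ ≡.sym) (v₀∉pq ∘ inj₂ ∘ ≡.sym)) D-pq

    U-rs : same U r s ≡ true
    U-rs = trans (U~M r s (∉-pair p≢r q≢r v∈pq) (∉-pair p≢s q≢s v∈pq)) M-rs
      where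
      v∈pq : In₂ p q v
      v∈pq = DelEq⇒endpoint {P = U} {M} U~M (mismatch U-pq M-pq)

    v₁∈rs : In₂ r s v₁
    v₁∈rs = DelEq⇒endpoint {P = U} {P} U~P (≢-sym (mismatch P-rs U-rs))

    p≢v₁ : p ≢ v₁
    p≢v₁ = ∉-pair (≢-sym p≢r) (≢-sym p≢s) v₁∈rs

    q≢v₁ : q ≢ v₁
    q≢v₁ = ∉-pair (≢-sym q≢r) (≢-sym q≢s) v₁∈rs

nonEdges-intersect : ∀ {n} {G : Graph n} {k} {U : BVert G k} →
                     k ≤ n ∸ 2 → BkUniversal G k U → Intersecting G
nonEdges-intersect {n} {G} {U = U} k≤n∸2 universal {p} {q} {r} {s} pq rs p≢r p≢s q≢r q≢s =
  bySide (v₀ Fin.≟ p ⊎-dec v₀ Fin.≟ q)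
  where
  agreeing : (Q : ISPartition G) → n ∸ 2 ≤ numParts Q → ∃[ v ] DelEq v (proj₁ U) Q
  agreeing Q bound = universal⇒DelEq {U = U} universal Q (ℕ.≤-trans k≤n∸2 bound) p

  D-agreement : ∃[ v ] DelEq v (proj₁ U) (discrete G)
  D-agreement = agreeing (discrete G)
    (subst (n ∸ 2 ≤_) (≡.sym (numParts-discrete G)) (ℕ.m∸n≤m n 2))
  v₀ : Fin n
  v₀ = proj₁ D-agreement

  M : ISPartition G
  M = matching G pq rs p≢r p≢s q≢r q≢s
  M-agreement : ∃[ v ] DelEq v (proj₁ U) M
  M-agreement = agreeing M (n∸2≤numParts-matching G pq rs p≢r p≢s q≢r q≢s)

  bySide : Dec (In₂ p q v₀) → ⊥
  bySide (no v₀∉pq) =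
    no-common-neighbour {U = proj₁ U} {discrete G} {M} {pairPartition G pq}
      p≢r p≢s q≢r q≢s v₀∉pq
      (proj₂ D-agreement) (discrete-separates G (distinct pq))
      (proj₂ M-agreement) (matching-joins₁ G pq rs p≢r p≢s q≢r q≢s)
                          (matching-joins₂ G pq rs p≢r p≢s q≢r q≢s)
      (proj₂ (agreeing (pairPartition G pq) (n∸2≤numParts-pairPartition G pq)))
      (pairPartition-joins G pq)
      (pairPartition-separates G pq (distinct rs) (≢-sym q≢r) (≢-sym q≢s))
  bySide (yes v₀∈pq) =
    no-common-neighbour {U = proj₁ U} {discrete G} {M} {pairPartition G rs}
      (≢-sym p≢r) (≢-sym q≢r) (≢-sym p≢s) (≢-sym q≢s) (In₂-disjoint p≢r p≢s q≢r q≢s v₀∈pq)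
      (proj₂ D-agreement) (discrete-separates G (distinct rs))
      (proj₂ M-agreement) (matching-joins₂ G pq rs p≢r p≢s q≢r q≢s)
                          (matching-joins₁ G pq rs p≢r p≢s q≢r q≢s)
      (proj₂ (agreeing (pairPartition G rs) (n∸2≤numParts-pairPartition G rs)))
      (pairPartition-joins G rs) (pairPartition-separates G rs (distinct pq) p≢s q≢s)

-- Intersecting families of non-edges

NoNonEdge : ∀ {n} → Graph n → Set
NoNonEdge G = ∀ {x y} → ¬ NonEdge G x y

Star : ∀ {n} → Graph n → Fin n → Set
Star G c = ∀ {x y} → NonEdge G x y → In₂ x y c

module _ {n : ℕ} {G : Graph n} where

  same-agree : (P Q : ISPartition G) {x y : Fin n} → (x ≢ y → ¬ NonEdge G x y) →
               same P x y ≡ same Q x y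
  same-agree P Q {x} {y} adjacent with x Fin.≟ y
  ... | yes refl = trans (same-refl P x) (≡.sym (same-refl Q x))
  ... | no x≢y   = trans (separated P) (≡.sym (separated Q))
    where
    separated : (R : ISPartition G) → same R x y ≡ false
    separated R = ¬-not (adjacent x≢y ∘ same⇒nonEdge R x≢y)

  noNonEdge⇒complete : NoNonEdge G → ∀ k → BkComplete G k
  noNonEdge⇒complete none k (P , _) (Q , _) P≉Q = ⊥-elim (P≉Q λ x y → same-agree P Q λ _ → none)

  star⇒complete : ∀ {c} → Star G c → ∀ k → BkComplete G k
  star⇒complete {c} star k (P , _) (Q , _) P≉Q = P≉Q , c , λ x y x≢c y≢c →
    same-agree P Q λ _ xy → [ x≢c ∘ ≡.sym , y≢c ∘ ≡.sym ]′ (star xy)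

  meet : Intersecting G → ∀ {x y r s} → NonEdge G x y → NonEdge G r s → x ≢ r → x ≢ s → In₂ r s y
  meet intersecting {y = y} {r} {s} xy rs x≢r x≢s with y Fin.≟ r | y Fin.≟ s
  ... | yes y≡r | _       = inj₁ y≡r
  ... | no _    | yes y≡s = inj₂ y≡s
  ... | no y≢r  | no y≢s  = ⊥-elim (intersecting xy rs x≢r x≢s y≢r y≢s)

  star-or-avoiding : (c : Fin n) → Star G c ⊎ ∃[ x ] ∃[ y ] NonEdge G x y × x ≢ c × y ≢ c
  star-or-avoiding c
    with Fin.any? (λ x → Fin.any? λ y → nonEdge? x y ×-dec ¬? (x Fin.≟ c) ×-dec ¬? (y Fin.≟ c))
  ... | yes (x , y , avoiding) = inj₂ (x , y , avoiding)
  ... | no none = inj₁ star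
    where
    star : Star G c
    star {x} {y} xy with c Fin.≟ x | c Fin.≟ y
    ... | yes c≡x | _       = inj₁ c≡x
    ... | no _    | yes c≡y = inj₂ c≡y
    ... | no c≢x  | no c≢y  = ⊥-elim (none (x , y , xy , ≢-sym c≢x , ≢-sym c≢y))

  avoiding⇒neighbour : Intersecting G → ∀ {a b x y} → NonEdge G a b → NonEdge G x y →
                       x ≢ a → y ≢ a → ∃[ w ] NonEdge G b w × w ≢ a
  avoiding⇒neighbour intersecting {b = b} {x} {y} ab xy x≢a y≢a with x Fin.≟ b
  ... | yes refl = y , xy , y≢a
  ... | no x≢b with meet intersecting xy ab x≢a x≢b
  ...   | inj₁ y≡a  = ⊥-elim (y≢a y≡a)
  ...   | inj₂ refl = x , nonEdge-sym xy , x≢a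

  sides⇒exact : Intersecting G → ∀ {a b c} → NonEdge G a b → NonEdge G a c → NonEdge G b c →
                ∀ {x y} → NonEdge G x y → In₃ a b c x
  sides⇒exact intersecting {a} {b} {c} ab ac bc {x} xy with x Fin.≟ a | x Fin.≟ b | x Fin.≟ c
  ... | yes x≡a | _       | _       = inj₁ x≡a
  ... | no _    | yes x≡b | _       = inj₂ (inj₁ x≡b)
  ... | no _    | no _    | yes x≡c = inj₂ (inj₂ x≡c)
  ... | no x≢a  | no x≢b  | no x≢c  with meet intersecting xy ab x≢a x≢b
  ...   | inj₁ refl = ⊥-elim ([ distinct ab , distinct ac ]′ (meet intersecting xy bc x≢b x≢c))
  ...   | inj₂ refl =
    ⊥-elim ([ distinct ab ∘ ≡.sym , distinct bc ]′ (meet intersecting xy ac x≢a x≢c))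

record NonEdgeTriangle {n : ℕ} (G : Graph n) : Set where
  constructor triangle
  field
    {a b c} : Fin n
    ab      : NonEdge G a b
    ac      : NonEdge G a c
    bc      : NonEdge G b c
    exact   : ∀ {x y} → NonEdge G x y → In₃ a b c x

classify : ∀ {n} {G : Graph n} → Intersecting G →
           NoNonEdge G ⊎ (∃[ c ] Star G c) ⊎ NonEdgeTriangle G
classify {G = G} intersecting with Fin.any? (λ x → Fin.any? λ y → nonEdge? {G = G} x y)
... | no none = inj₁ λ {x} {y} xy → none (x , y , xy)
... | yes (a , b , ab) with star-or-avoiding a | star-or-avoiding b
...   | inj₁ star-a | _           = inj₂ (inj₁ (a , star-a))
...   | inj₂ _      | inj₁ star-b = inj₂ (inj₁ (b , star-b))
...   | inj₂ (_ , _ , xy , x≢a , y≢a) | inj₂ (_ , _ , x′y′ , x′≢b , y′≢b)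
  with w , bw , w≢a ← avoiding⇒neighbour intersecting ab xy x≢a y≢a
  with w′ , aw′ , w′≢b ← avoiding⇒neighbour intersecting (nonEdge-sym ab) x′y′ x′≢b y′≢b
  with meet intersecting bw aw′ (≢-sym (distinct ab)) (≢-sym w′≢b)
... | inj₁ w≡a  = ⊥-elim (w≢a w≡a)
... | inj₂ refl = inj₂ (inj₂ (triangle ab aw′ bw (sides⇒exact intersecting ab aw′ bw)))

-- The five partitions of a triangle

-- Codes for the partitions of the corners {0, 1, 2}: discrete, one part, {0,1}, {0,2}, {1,2}.
-- Codes 0 and 1 are the pair that K₅⁻ leaves non-adjacent.
rep : Fin 5 → Fin 3 → Fin 3
rep 0F s  = s
rep 1F _  = 0F
rep 2F 2F = 2F
rep 2F _  = 0F
rep 3F 1F = 1F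
rep 3F _  = 0F
rep 4F 0F = 0F
rep 4F _  = 1F

sameRep : Fin 5 → Fin 3 → Fin 3 → Bool
sameRep i s t = does (rep i s Fin.≟ rep i t)

sameRep-sym : ∀ i s t → sameRep i s t ≡ sameRep i t s
sameRep-sym i s t = does-⇔ (mk⇔ ≡.sym ≡.sym) (rep i s Fin.≟ rep i t) (rep i t Fin.≟ rep i s)

-- The arguments say whether the sides 12, 02, 01 lie in a part; the three triples that
-- violate transitivity never occur and get the junk value 0.
code : Bool → Bool → Bool → Fin 5
code false false false = 0F
code true  true  true  = 1F
code false false true  = 2F
code false true  false = 3F
code true  false false = 4F
code _     _     _     = 0F

code-sameRep : ∀ x y z →
  (y ≡ true → z ≡ true → x ≡ true) → (z ≡ true → x ≡ true → y ≡ true) →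
  (x ≡ true → y ≡ true → z ≡ true) →
  sameRep (code x y z) 1F 2F ≡ x × sameRep (code x y z) 0F 2F ≡ y × sameRep (code x y z) 0F 1F ≡ z
code-sameRep false false false _ _ _ = refl , refl , refl
code-sameRep true  true  true  _ _ _ = refl , refl , refl
code-sameRep false false true  _ _ _ = refl , refl , refl
code-sameRep false true  false _ _ _ = refl , refl , refl
code-sameRep true  false false _ _ _ = refl , refl , refl
code-sameRep false true  true  yz⇒x _ _ with () ← yz⇒x refl refl
code-sameRep true  false true  _ zx⇒y _ with () ← zx⇒y refl refl
code-sameRep true  true  false _ _ xy⇒z with () ← xy⇒z refl refl

code-sameRep-rep : ∀ i → code (sameRep i 1F 2F) (sameRep i 0F 2F) (sameRep i 0F 1F) ≡ i
code-sameRep-rep 0F = refl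
code-sameRep-rep 1F = refl
code-sameRep-rep 2F = refl
code-sameRep-rep 3F = refl
code-sameRep-rep 4F = refl

AgreeOff : Fin 3 → Fin 5 → Fin 5 → Set
AgreeOff t i j = ∀ s s′ → s ≢ t → s′ ≢ t → sameRep i s s′ ≡ sameRep j s s′

TriAdj : Fin 5 → Fin 5 → Set
TriAdj i j = i ≢ j × ∃[ t ] AgreeOff t i j

K5⁻Adj⇔TriAdj : ∀ i j → K5⁻Adj i j ⇔ TriAdj i j
K5⁻Adj⇔TriAdj i j = mk⇔ (proj₁ (from-yes check i j)) (proj₂ (from-yes check i j))
  where
  AgreeOff? : ∀ t i j → Dec (AgreeOff t i j)
  AgreeOff? t i j = Fin.all? λ s → Fin.all? λ s′ →
    ¬? (s Fin.≟ t) →-dec (¬? (s′ Fin.≟ t) →-dec (sameRep i s s′ Bool.≟ sameRep j s s′))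

  TriAdj? : ∀ i j → Dec (TriAdj i j)
  TriAdj? i j = ¬? (i Fin.≟ j) ×-dec Fin.any? λ t → AgreeOff? t i j

  K5⁻Adj? : ∀ i j → Dec (K5⁻Adj i j)
  K5⁻Adj? i j = ¬? (i Fin.≟ j) ×-dec ¬? (toℕ i ℕ.≟ 0 ×-dec toℕ j ℕ.≟ 1)
                               ×-dec ¬? (toℕ i ℕ.≟ 1 ×-dec toℕ j ℕ.≟ 0)

  check : Dec (∀ i j → (K5⁻Adj i j → TriAdj i j) × (TriAdj i j → K5⁻Adj i j))
  check = Fin.all? λ i → Fin.all? λ j →
    (K5⁻Adj? i j →-dec TriAdj? i j) ×-dec (TriAdj? i j →-dec K5⁻Adj? i j)

module _ {n : ℕ} {G : Graph n} (T : NonEdgeTriangle G) where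
  open NonEdgeTriangle T

  corner : Fin 3 → Fin n
  corner 0F = a
  corner 1F = b
  corner 2F = c

  side : ∀ s t → s ≢ t → NonEdge G (corner s) (corner t)
  side 0F 1F _   = ab
  side 0F 2F _   = ac
  side 1F 2F _   = bc
  side 1F 0F _   = nonEdge-sym ab
  side 2F 0F _   = nonEdge-sym ac
  side 2F 1F _   = nonEdge-sym bc
  side 0F 0F s≢s = ⊥-elim (s≢s refl)
  side 1F 1F s≢s = ⊥-elim (s≢s refl)
  side 2F 2F s≢s = ⊥-elim (s≢s refl)

  corner-injective : ∀ {s t} → corner s ≡ corner t → s ≡ t
  corner-injective {s} {t} cs≡ct with s Fin.≟ t
  ... | yes s≡t = s≡t
  ... | no s≢t  = ⊥-elim (distinct (side s t s≢t) cs≡ct)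

  Corner : Fin n → Set
  Corner x = ∃[ s ] corner s ≡ x

  corner? : ∀ x → Dec (Corner x)
  corner? x = Fin.any? λ s → corner s Fin.≟ x

  nonEdge⇒corner : ∀ {x y} → NonEdge G x y → Corner x
  nonEdge⇒corner xy with exact xy
  ... | inj₁ refl        = 0F , refl
  ... | inj₂ (inj₁ refl) = 1F , refl
  ... | inj₂ (inj₂ refl) = 2F , refl

  same-nonCorner : (P : ISPartition G) {x y : Fin n} → ¬ Corner x → x ≢ y → same P x y ≡ false
  same-nonCorner P ¬corner x≢y = ¬-not (¬corner ∘ nonEdge⇒corner ∘ same⇒nonEdge P x≢y)

  same-nonCornerʳ : (P : ISPartition G) {x y : Fin n} → ¬ Corner y → x ≢ y → same P x y ≡ false
  same-nonCornerʳ P {x} {y} ¬corner x≢y =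
    trans (same-sym P x y) (same-nonCorner P ¬corner (≢-sym x≢y))

  agree-on-corners : (P Q : ISPartition G) {x y : Fin n} →
    (∀ {s t} → corner s ≡ x → corner t ≡ y → same P x y ≡ same Q x y) → same P x y ≡ same Q x y
  agree-on-corners P Q {x} {y} on-corners with x Fin.≟ y | corner? x | corner? y
  ... | yes refl | _              | _              = trans (same-refl P x) (≡.sym (same-refl Q x))
  ... | no _     | yes (s , cs≡x) | yes (t , ct≡y) = on-corners {s} {t} cs≡x ct≡y
  ... | no x≢y   | no ¬cx         | _              =
    trans (same-nonCorner P ¬cx x≢y) (≡.sym (same-nonCorner Q ¬cx x≢y))
  ... | no x≢y   | _              | no ¬cy         =
    trans (same-nonCornerʳ P ¬cy x≢y) (≡.sym (same-nonCornerʳ Q ¬cy x≢y))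

  n∸2≤numParts-triangle : (P : ISPartition G) → n ∸ 2 ≤ numParts P
  n∸2≤numParts-triangle P = n∸2≤numParts-within₃ P λ x≢y x~y → exact (same⇒nonEdge P x≢y x~y)

  label : Fin 5 → Fin n → Fin 3 ⊎ Fin n
  label i x with corner? x
  ... | yes (s , _) = inj₁ (rep i s)
  ... | no _        = inj₂ x

  label-corner : ∀ i s → label i (corner s) ≡ inj₁ (rep i s)
  label-corner i s with corner? (corner s)
  ... | yes (_ , ct≡cs) = cong (inj₁ ∘ rep i) (corner-injective ct≡cs)
  ... | no ¬corner      = ⊥-elim (¬corner (s , refl))

  label-fibre : ∀ i {x y} → x ≢ y → label i x ≡ label i y → Corner x × Corner y
  label-fibre i {x} {y} x≢y lx≡ly with corner? x | corner? y
  ... | yes cx | yes cy = cx , cy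
  ... | yes _  | no _   with () ← lx≡ly
  ... | no _   | yes _  with () ← lx≡ly
  ... | no _   | no _   = ⊥-elim (x≢y (Sum.inj₂-injective lx≡ly))

  triPartition : Fin 5 → ISPartition G
  triPartition i = fibres G (Sum.≡-dec Fin._≟_ Fin._≟_) (label i) independent
    where
    independent : ∀ {x y} → x ≢ y → label i x ≡ label i y → adj G x y ≡ false
    independent x≢y lx≡ly with (s , refl) , (t , refl) ← label-fibre i x≢y lx≡ly =
      nonadjacent (side s t (x≢y ∘ cong corner))

  same-triPartition : ∀ i s t → same (triPartition i) (corner s) (corner t) ≡ sameRep i s t
  same-triPartition i s t =
    cong₂ (λ u v → does (Sum.≡-dec Fin._≟_ Fin._≟_ u v)) (label-corner i s) (label-corner i t)

  encode : ISPartition G → Fin 5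
  encode P = code (same P b c) (same P a c) (same P a b)

  encode-resp : {P Q : ISPartition G} → P ≈P Q → encode P ≡ encode Q
  encode-resp {P} {Q} P≈Q rewrite P≈Q b c | P≈Q a c | P≈Q a b = refl

  sameRep-encode : (P : ISPartition G) →
                   ∀ s t → sameRep (encode P) s t ≡ same P (corner s) (corner t)
  sameRep-encode P = on-sides
    where
    bits = code-sameRep (same P b c) (same P a c) (same P a b)
      (λ ac′ ab′ → same-trans P b a c (trans (same-sym P b a) ab′) ac′)
      (λ ab′ bc′ → same-trans P a b c ab′ bc′)
      (λ bc′ ac′ → same-trans P a c b ac′ (trans (same-sym P c b) bc′))

    diagonal : ∀ s → sameRep (encode P) s s ≡ same P (corner s) (corner s)
    diagonal s = trans (dec-true (rep (encode P) s Fin.≟ _) refl) (≡.sym (same-refl P (corner s)))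

    flipped : ∀ {s t} → sameRep (encode P) s t ≡ same P (corner s) (corner t) →
              sameRep (encode P) t s ≡ same P (corner t) (corner s)
    flipped {s} {t} e =
      trans (sameRep-sym (encode P) t s) (trans e (same-sym P (corner s) (corner t)))

    on-sides : ∀ s t → sameRep (encode P) s t ≡ same P (corner s) (corner t)
    on-sides 0F 0F = diagonal 0F
    on-sides 1F 1F = diagonal 1F
    on-sides 2F 2F = diagonal 2F
    on-sides 1F 2F = proj₁ bits
    on-sides 0F 2F = proj₁ (proj₂ bits)
    on-sides 0F 1F = proj₂ (proj₂ bits)
    on-sides 2F 1F = flipped (proj₁ bits)
    on-sides 2F 0F = flipped (proj₁ (proj₂ bits))
    on-sides 1F 0F = flipped (proj₂ (proj₂ bits))

  triPartition-encode : (P : ISPartition G) → triPartition (encode P) ≈P P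
  triPartition-encode P x y = agree-on-corners (triPartition (encode P)) P λ
    { {s} {t} refl refl → trans (same-triPartition (encode P) s t) (sameRep-encode P s t) }

  encode-triPartition : ∀ i → encode (triPartition i) ≡ i
  encode-triPartition i = begin
    code (same (triPartition i) b c) (same (triPartition i) a c) (same (triPartition i) a b)
      ≡⟨ cong₂ (λ x (yz : Bool × Bool) → code x (proj₁ yz) (proj₂ yz)) (same-triPartition i 1F 2F)
               (cong₂ _,_ (same-triPartition i 0F 2F) (same-triPartition i 0F 1F)) ⟩
    code (sameRep i 1F 2F) (sameRep i 0F 2F) (sameRep i 0F 1F)
      ≡⟨ code-sameRep-rep i ⟩
    i ∎
    where open ≡-Reasoning

  sameRep-agree : ∀ {v i j s s′} → DelEq v (triPartition i) (triPartition j) →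
                  corner s ≢ v → corner s′ ≢ v → sameRep i s s′ ≡ sameRep j s s′
  sameRep-agree {i = i} {j} {s} {s′} agree cs≢v cs′≢v =
    trans (≡.sym (same-triPartition i s s′))
      (trans (agree _ _ cs≢v cs′≢v) (same-triPartition j s s′))

  DelEq⇒AgreeOff : ∀ {v i j} → DelEq v (triPartition i) (triPartition j) → ∃[ t ] AgreeOff t i j
  DelEq⇒AgreeOff {v} agree with corner? v
  ... | yes (t , ct≡v) = t , λ s s′ s≢t s′≢t → sameRep-agree agree
    (λ cs≡v → s≢t (corner-injective (trans cs≡v (≡.sym ct≡v))))
    (λ cs′≡v → s′≢t (corner-injective (trans cs′≡v (≡.sym ct≡v))))
  ... | no ¬corner = 0F , λ s s′ _ _ → sameRep-agree agree (¬corner ∘ (s ,_)) (¬corner ∘ (s′ ,_))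

  AgreeOff⇒DelEq : ∀ {t i j} → AgreeOff t i j → DelEq (corner t) (triPartition i) (triPartition j)
  AgreeOff⇒DelEq {t} {i} {j} agree x y x≢ct y≢ct =
    agree-on-corners (triPartition i) (triPartition j) λ
      { {s} {s′} refl refl → trans (same-triPartition i s s′)
          (trans (agree s s′ (x≢ct ∘ cong corner) (y≢ct ∘ cong corner))
                 (≡.sym (same-triPartition j s s′))) }

  BAdj-triPartition : ∀ i j → BAdj (triPartition i) (triPartition j) ⇔ TriAdj i j
  BAdj-triPartition i j = mk⇔
    (λ (≉ , _ , agree) → (λ { refl → ≉ λ _ _ → refl }) , DelEq⇒AgreeOff agree)
    (λ (i≢j , t , agree) → (λ ≈ → i≢j (begin
        i                           ≡⟨ encode-triPartition i ⟨
        encode (triPartition i)     ≡⟨ encode-resp {triPartition i} {triPartition j} ≈ ⟩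
        encode (triPartition j)     ≡⟨ encode-triPartition j ⟩
        j                           ∎))
      , corner t , AgreeOff⇒DelEq agree)
    where open ≡-Reasoning

  triangle⇒K5⁻ : ∀ {k} → k ≤ n ∸ 2 → BkIsoK5⁻ G k
  triangle⇒K5⁻ {k} k≤n∸2 =
    to , from , (λ P Q → encode-resp {proj₁ P} {proj₁ Q}) , (triPartition-encode ∘ proj₁) ,
    encode-triPartition , adjacency
    where
    to : BVert G k → Fin 5
    to = encode ∘ proj₁

    from : Fin 5 → BVert G k
    from i = triPartition i , ℕ.≤-trans k≤n∸2 (n∸2≤numParts-triangle (triPartition i))

    adjacency : ∀ P Q → BkAdj P Q ⇔ K5⁻Adj (to P) (to Q)
    adjacency (P , _) (Q , _) =
      ⇔.trans (BAdj-cong {P = P} {triPartition (encode P)} {Q} {triPartition (encode Q)}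
                 (≈P-sym {P = triPartition (encode P)} {P} (triPartition-encode P))
                 (≈P-sym {P = triPartition (encode Q)} {Q} (triPartition-encode Q)))
        (⇔.trans (BAdj-triPartition (encode P) (encode Q))
                 (⇔.sym (K5⁻Adj⇔TriAdj (encode P) (encode Q))))

lemmaA5 : (n : ℕ) (G : Graph n) (k : ℕ) → k ≤ n →
    ¬ BkComplete G k → ¬ BkIsoK5⁻ G k →
    (k ≤ n ∸ 2 ⇔ (¬ (∃[ P ] BkUniversal G k P)))
lemmaA5 n G k k≤n ¬complete ¬K5⁻ = mk⇔ no-universal bounded
  where
  no-universal : k ≤ n ∸ 2 → ¬ (∃[ P ] BkUniversal G k P)
  no-universal k≤n∸2 (U , universal) with classify (nonEdges-intersect {U = U} k≤n∸2 universal)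
  ... | inj₁ none              = ¬complete (noNonEdge⇒complete none k)
  ... | inj₂ (inj₁ (_ , star)) = ¬complete (star⇒complete star k)
  ... | inj₂ (inj₂ T)          = ¬K5⁻ (triangle⇒K5⁻ T k≤n∸2)

  bounded : ¬ (∃[ P ] BkUniversal G k P) → k ≤ n ∸ 2
  bounded ¬universal with k ℕ.≤? n ∸ 2
  ... | yes k≤n∸2 = k≤n∸2
  ... | no k≰n∸2  =
    ⊥-elim (¬universal (discreteVertex G k≤n , discrete-universal G k≤n (ℕ.≰⇒> k≰n∸2)))
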